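{- Let $s$ be a term, $v$ an F-term and $\rho,\rho'$ substitutions such that $s\sqsubseteq v[\rho]$ and, for all tyvars $\alpha$ and positions $p$, if $p\in\mathrm{Poss}(v)$, $\alpha\in\mathrm{TV}(\mathrm{tpOf}(v,p))$ and $\mathrm{mtpOf}(s,p)\neq\bot$, then $\rho(\alpha)=\rho'(\alpha)$. Then $s\sqsubseteq v[\rho']$.
   Context: Types: $\sigma ::= \alpha \mid \sigma\Rightarrow\tau \mid (\sigma_1,\dots,\sigma_n)\,\kappa$ over type variables (tyvars) $\alpha$ and type constructors $\kappa$ with arities. A substitution $\rho$ maps tyvars to types (finite support); $\sigma[\rho]$ its application; $\mathrm{TV}(\sigma)$ the tyvars of $\sigma$. Maybe-types: types or $\bot$, with $\bot[\rho]=\bot$. Terms: $t ::= x_\xi \mid c_\xi \mid (t_1\,t_2)_\xi \mid (\lambda x_\xi.\,t)_\zeta$ with $\xi,\zeta$ maybe-types; $t[\rho]$ applies $\rho$ to all decorations. F-term: all decorations are types. Positions: $\mathrm{Poss}(x_\xi)=\mathrm{Poss}(c_\xi)=\{[]\}$, $\mathrm{Poss}((t\,s)_\xi)=\{[]\}\cup1\cdot\mathrm{Poss}(t)\cup2\cdot\mathrm{Poss}(s)$, $\mathrm{Poss}((\lambda x_\xi.t)_\zeta)=\{[],[1]\}\cup2\cdot\mathrm{Poss}(t)$. $\mathrm{mtpOf}(t,p)$: decoration at position $p$ ($\xi$ at $[]$ for $x_\xi,c_\xi$; for $(t_1t_2)_\xi$: $\xi$ at $[]$, $\mathrm{mtpOf}(t_i,p')$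 at $i\cdot p'$; for $(\lambda x_\xi.t)_\zeta$: $\zeta$ at $[]$, $\xi$ at $[1]$, $\mathrm{mtpOf}(t,p')$ at $2\cdot p'$), written $\mathrm{tpOf}$ for F-terms. Annotation subsumption: $\xi\sqsubseteq\zeta$ iff $\xi\in\{\bot,\zeta\}$; $x_\xi\sqsubseteq x_\zeta$, $c_\xi\sqsubseteq c_\zeta$ iff $\xi\sqsubseteq\zeta$; applications and abstractions componentwise (including the binder decoration). -}

module Defs where

open import Data.Nat using (ℕ)
open import Data.List using (List; []; _∷_)
open import Data.List.Relation.Unary.Any using (Any)
open import Data.Maybe using (Maybe; just; nothing)
open import Relation.Binary.PropositionalEquality using (_≡_)

-- Type variables, type-constructor names, variable and constant names: ℕ.
TyVar : Set
TyVar = ℕ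

data Type : Set where
  tv   : TyVar → Type
  _⇒_  : Type → Type → Type
  tcon : ℕ → List Type → Type

Subst : Set
Subst = TyVar → Type

mutual
  _[_]ᵗ : Type → Subst → Type
  tv α [ ρ ]ᵗ = ρ α
  (σ ⇒ τ) [ ρ ]ᵗ = (σ [ ρ ]ᵗ) ⇒ (τ [ ρ ]ᵗ)
  tcon κ σs [ ρ ]ᵗ = tcon κ (substList σs ρ)

  substList : List Type → Subst → List Type
  substList [] ρ = []
  substList (σ ∷ σs) ρ = (σ [ ρ ]ᵗ) ∷ substList σs ρ

data _∈TV_ (α : TyVar) : Type → Set where
  tv-here : α ∈TV tv α
  tv-⇒ˡ   : ∀ {σ τ} → α ∈TV σ → α ∈TV (σ ⇒ τ)
  tv-⇒ʳ   : ∀ {σ τ} → α ∈TV τ → α ∈TV (σ ⇒ τ)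
  tv-con  : ∀ {κ σs} → Any (α ∈TV_) σs → α ∈TV tcon κ σs

data MType : Set where
  ⊥ₘ : MType
  ty : Type → MType

_[_]ᵐ : MType → Subst → MType
⊥ₘ [ ρ ]ᵐ = ⊥ₘ
ty σ [ ρ ]ᵐ = ty (σ [ ρ ]ᵗ)

data Term : Set where
  var : ℕ → MType → Term
  con : ℕ → MType → Term
  app : Term → Term → MType → Term
  lam : ℕ → MType → Term → MType → Term   -- (λ x_ξ. t)_ζ  =  lam x ξ t ζ

_[_] : Term → Subst → Term
var x ξ [ ρ ] = var x (ξ [ ρ ]ᵐ)
con c ξ [ ρ ] = con c (ξ [ ρ ]ᵐ)
app t s ξ [ ρ ] = app (t [ ρ ]) (s [ ρ ]) (ξ [ ρ ]ᵐ)
lam x ξ t ζ [ ρ ] = lam x (ξ [ ρ ]ᵐ) (t [ ρ ]) (ζ [ ρ ]ᵐ)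

data IsFTerm : Term → Set where
  var-F : ∀ {x σ} → IsFTerm (var x (ty σ))
  con-F : ∀ {c σ} → IsFTerm (con c (ty σ))
  app-F : ∀ {t s σ} → IsFTerm t → IsFTerm s → IsFTerm (app t s (ty σ))
  lam-F : ∀ {x σ t τ} → IsFTerm t → IsFTerm (lam x (ty σ) t (ty τ))

Pos : Set
Pos = List ℕ

data _∈Poss_ : Pos → Term → Set where
  p-var  : ∀ {x ξ} → [] ∈Poss var x ξ
  p-con  : ∀ {c ξ} → [] ∈Poss con c ξ
  p-app  : ∀ {t s ξ} → [] ∈Poss app t s ξ
  p-app1 : ∀ {t s ξ p} → p ∈Poss t → (1 ∷ p) ∈Poss app t s ξ
  p-app2 : ∀ {t s ξ p} → p ∈Poss s → (2 ∷ p) ∈Poss app t s ξ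
  p-lam  : ∀ {x ξ t ζ} → [] ∈Poss lam x ξ t ζ
  p-lamb : ∀ {x ξ t ζ} → (1 ∷ []) ∈Poss lam x ξ t ζ
  p-lam2 : ∀ {x ξ t ζ p} → p ∈Poss t → (2 ∷ p) ∈Poss lam x ξ t ζ

-- mtpOf(t,p); `nothing` when p is not a position of t.
mtpOf : Term → Pos → Maybe MType
mtpOf (var x ξ) [] = just ξ
mtpOf (con c ξ) [] = just ξ
mtpOf (app t s ξ) [] = just ξ
mtpOf (app t s ξ) (1 ∷ p) = mtpOf t p
mtpOf (app t s ξ) (2 ∷ p) = mtpOf s p
mtpOf (lam x ξ t ζ) [] = just ζ
mtpOf (lam x ξ t ζ) (1 ∷ []) = just ξ
mtpOf (lam x ξ t ζ) (2 ∷ p) = mtpOf t p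
mtpOf _ _ = nothing

-- tpOf(v,p) = σ for F-terms, as a relation.
_at_hasType_ : Term → Pos → Type → Set
v at p hasType σ = mtpOf v p ≡ just (ty σ)

data _⊑ᵐ_ : MType → MType → Set where
  ⊑-⊥    : ∀ {ζ} → ⊥ₘ ⊑ᵐ ζ
  ⊑-refl : ∀ {ζ} → ζ ⊑ᵐ ζ

data _⊑_ : Term → Term → Set where
  ⊑-var : ∀ {x ξ ζ} → ξ ⊑ᵐ ζ → var x ξ ⊑ var x ζ
  ⊑-con : ∀ {c ξ ζ} → ξ ⊑ᵐ ζ → con c ξ ⊑ con c ζ
  ⊑-app : ∀ {t t' s s' ξ ζ} → t ⊑ t' → s ⊑ s' → ξ ⊑ᵐ ζ → app t s ξ ⊑ app t' s' ζ
  ⊑-lam : ∀ {x ξ ξ' t t' ζ ζ'} → ξ ⊑ᵐ ξ' → t ⊑ t' → ζ ⊑ᵐ ζ' →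
          lam x ξ t ζ ⊑ lam x ξ' t' ζ'

{-# OPTIONS --safe #-}
-- Substitution acts on each decoration of v separately, and s ⊑ v[ρ] compares s with a
-- decoration of v[ρ] only where s itself is decorated (a ⊥ in s matches anything).  At such a
-- position ρ and ρ' agree on the type variables of the decoration, so it is the same under both.
module Submission where

open import Defs
open import Data.Maybe using (just)
open import Data.Maybe.Properties using (just-injective)
open import Data.List using (List; []; _∷_)
open import Data.List.Relation.Unary.Any using (Any; here; there)
open import Function using (_∘_)
open import Relation.Binary.PropositionalEquality
  using (_≡_; _≢_; refl; sym; trans; cong; cong₂; subst)

mutual
  substᵗ-agree : ∀ σ {ρ ρ' : Subst} → (∀ α → α ∈TV σ → ρ α ≡ ρ' α) → σ [ ρ ]ᵗ ≡ σ [ ρ' ]ᵗ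
  substᵗ-agree (tv α)      agree = agree α tv-here
  substᵗ-agree (σ ⇒ τ)     agree = cong₂ _⇒_ (substᵗ-agree σ (λ α → agree α ∘ tv-⇒ˡ))
                                             (substᵗ-agree τ (λ α → agree α ∘ tv-⇒ʳ))
  substᵗ-agree (tcon κ σs) agree = cong (tcon κ) (substList-agree σs (λ α → agree α ∘ tv-con))

  substList-agree : ∀ σs {ρ ρ' : Subst} → (∀ α → Any (α ∈TV_) σs → ρ α ≡ ρ' α) →
                    substList σs ρ ≡ substList σs ρ'
  substList-agree []       agree = refl
  substList-agree (σ ∷ σs) agree = cong₂ _∷_ (substᵗ-agree σ (λ α → agree α ∘ here))
                                             (substList-agree σs (λ α → agree α ∘ there))

⊑ᵐ-replaceʳ : ∀ {ξ ζ ζ'} → ξ ⊑ᵐ ζ → (ξ ≢ ⊥ₘ → ζ ≡ ζ') → ξ ⊑ᵐ ζ'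
⊑ᵐ-replaceʳ             ⊑-⊥    _  = ⊑-⊥
⊑ᵐ-replaceʳ {ζ = ⊥ₘ}   ⊑-refl _  = ⊑-⊥
⊑ᵐ-replaceʳ {ζ = ty σ} ⊑-refl eq = subst (ty σ ⊑ᵐ_) (eq λ ()) ⊑-refl

AgreeWhereDecorated : Term → Term → Subst → Subst → Set
AgreeWhereDecorated s v ρ ρ' =
  ∀ α p σ → p ∈Poss v → v at p hasType σ → α ∈TV σ → mtpOf s p ≢ just ⊥ₘ → ρ α ≡ ρ' α

module _ {ρ ρ' : Subst} where

  decoration-agree : ∀ s {v p ξ ζ} → AgreeWhereDecorated s v ρ ρ' → p ∈Poss v →
                     mtpOf s p ≡ just ξ → mtpOf v p ≡ just ζ → ξ ≢ ⊥ₘ → ζ [ ρ ]ᵐ ≡ ζ [ ρ' ]ᵐ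
  decoration-agree _ {ζ = ⊥ₘ}   _     _  _    _    _      = refl
  decoration-agree _ {ζ = ty σ} agree pp at-s at-v ξ≢⊥ = cong ty (substᵗ-agree σ λ α α∈σ →
    agree α _ σ pp at-v α∈σ (ξ≢⊥ ∘ just-injective ∘ trans (sym at-s)))

  ⊑ᵐ-resubst : ∀ s {v p ξ ζ} → AgreeWhereDecorated s v ρ ρ' → p ∈Poss v →
               mtpOf s p ≡ just ξ → mtpOf v p ≡ just ζ → ξ ⊑ᵐ (ζ [ ρ ]ᵐ) → ξ ⊑ᵐ (ζ [ ρ' ]ᵐ)
  ⊑ᵐ-resubst s agree pp at-s at-v ξ⊑ζ = ⊑ᵐ-replaceʳ ξ⊑ζ (decoration-agree s agree pp at-s at-v)

  ⊑-resubst : ∀ {s} v → s ⊑ (v [ ρ ]) → AgreeWhereDecorated s v ρ ρ' → s ⊑ (v [ ρ' ])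
  ⊑-resubst {s} (var x ζ) (⊑-var a) agree = ⊑-var (⊑ᵐ-resubst s agree p-var refl refl a)
  ⊑-resubst {s} (con c ζ) (⊑-con a) agree = ⊑-con (⊑ᵐ-resubst s agree p-con refl refl a)
  ⊑-resubst {s} (app v₁ v₂ ζ) (⊑-app s₁⊑ s₂⊑ a) agree =
    ⊑-app (⊑-resubst v₁ s₁⊑ (λ α p σ → agree α (1 ∷ p) σ ∘ p-app1))
          (⊑-resubst v₂ s₂⊑ (λ α p σ → agree α (2 ∷ p) σ ∘ p-app2))
          (⊑ᵐ-resubst s agree p-app refl refl a)
  ⊑-resubst {s} (lam x ξ v ζ) (⊑-lam b body⊑ a) agree =
    ⊑-lam (⊑ᵐ-resubst s agree p-lamb refl refl b)
          (⊑-resubst v body⊑ (λ α p σ → agree α (2 ∷ p) σ ∘ p-lam2))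
          (⊑ᵐ-resubst s agree p-lam refl refl a)

lemma3 : (s v : Term) (ρ ρ' : Subst) → IsFTerm v → s ⊑ (v [ ρ ]) →
         (∀ (α : TyVar) (p : Pos) (σ : Type) → p ∈Poss v → v at p hasType σ → α ∈TV σ →
            mtpOf s p ≢ just ⊥ₘ → ρ α ≡ ρ' α) →
         s ⊑ (v [ ρ' ])
-- v need not be an F-term: a ⊥ decoration of v is fixed by every substitution.
lemma3 s v ρ ρ' _ = ⊑-resubst v
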